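{- Let $L$ be a finite lattice and let $(A_1,\dots,A_n)$ be the ordered partition of the atoms of $L$ induced by a multichain $C:\hat{0}=x_0\leq x_1\leq\cdots\leq x_n=\hat{1}$. For $x\in L$ and each $i$ let $N_i(x)=|A_i\cap A_x|$ be the number of atoms below $x$ lying in $A_i$. Suppose $x\neq\hat{0}$ satisfies $N_i(x)\neq1$ for all $i$, and $x$ is minimal (in the order of $L$) among nonzero elements with this property. Then $N_i(x)=0$ for all but one index $i$.
   Context: The ordered partition $(A_1,\dots,A_n)$ induced by the multichain $C$ is given by $A_i=\{a \text{ an atom of } L : a\leq x_i \text{ and } a\not\leq x_{i-1}\}$ (blocks may be empty). $A_x$ denotes the set of atoms of $L$ below $x$. -}

module Defs where

open import Level using (Level)
open import Data.Nat using (ℕ; zero; suc; _+_)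
open import Data.Fin using (Fin; zero; suc; inject₁; fromℕ)
open import Data.Fin.Properties using (all?)
open import Data.Product using (Σ; ∃; _×_; _,_; proj₁; proj₂)
open import Relation.Nullary using (¬_; Dec; yes; no)
open import Relation.Nullary.Decidable using (_×-dec_; ¬?)
open import Relation.Binary using (Decidable)
open import Relation.Binary.PropositionalEquality using (_≡_)
open import Relation.Binary.Lattice.Bundles using (BoundedLattice)

-- A finite lattice: a bounded lattice (every finite nonempty lattice is
-- bounded) whose carrier is in bijection (up to the setoid equality ≈)
-- with Fin size, and whose order is decidable (automatic classically
-- for a finite lattice; needed constructively to count atoms).
record FiniteLattice (c ℓ₁ ℓ₂ : Level) : Set (Level.suc (c Level.⊔ ℓ₁ Level.⊔ ℓ₂)) where
  field
    boundedLattice : BoundedLattice c ℓ₁ ℓ₂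
  open BoundedLattice boundedLattice public
  field
    size      : ℕ
    enum      : Fin size → Carrier
    enum-surj : ∀ x → ∃ λ i → enum i ≈ x
    enum-inj  : ∀ i j → enum i ≈ enum j → i ≡ j
    _≤?_      : Decidable _≤_

module FL {c ℓ₁ ℓ₂} (L : FiniteLattice c ℓ₁ ℓ₂) where
  open FiniteLattice L

  _<_ : Carrier → Carrier → Set _
  x < y = (x ≤ y) × ¬ (x ≈ y)

  IsAtom : Carrier → Set _
  IsAtom a = (⊥ < a) × (∀ y → ⊥ < y → y ≤ a → y ≈ a)

  _≈?_ : Decidable _≈_
  x ≈? y with x ≤? y | y ≤? x
  ... | yes p | yes q = yes (antisym p q)
  ... | no ¬p | _ = no λ e → ¬p (reflexive e)
  ... | yes _ | no ¬q = no λ e → ¬q (reflexive (Eq.sym e))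

  _<?_ : Decidable _<_
  x <? y = (x ≤? y) ×-dec ¬? (x ≈? y)

  private
    P : Carrier → Fin size → Set _
    P a j = ⊥ < enum j → enum j ≤ a → enum j ≈ a

    P? : ∀ a → (j : Fin size) → Dec (P a j)
    P? a j with ⊥ <? enum j | enum j ≤? a | enum j ≈? a
    ... | _ | _ | yes e = yes λ _ _ → e
    ... | no n | _ | no _ = yes λ p → Data.Empty.⊥-elim (n p)
      where import Data.Empty
    ... | yes _ | no n | no _ = yes λ _ q → Data.Empty.⊥-elim (n q)
      where import Data.Empty
    ... | yes p | yes q | no n = no λ f → n (f p q)

    lt-resp : ∀ {y z} → y ≈ z → ⊥ < z → ⊥ < y
    lt-resp e (p , n) = ≤-respʳ-≈ (Eq.sym e) p , λ b → n (Eq.trans b e)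

  isAtom? : (a : Carrier) → Dec (IsAtom a)
  isAtom? a with ⊥ <? a | all? (P? a)
  ... | no n | _ = no λ at → n (proj₁ at)
  ... | yes p | yes f = yes (p , λ y b q →
          let (j , e) = enum-surj y
          in Eq.trans (Eq.sym e) (f j (lt-resp e b) (≤-respˡ-≈ (Eq.sym e) q)))
  ... | yes p | no nf = no λ at → nf λ j b q → proj₂ at (enum j) b q

  count : ∀ {n p} {Q : Fin n → Set p} → (∀ j → Dec (Q j)) → ℕ
  count {zero} Q? = 0
  count {suc n} Q? with Q? zero
  ... | yes _ = suc (count (λ j → Q? (suc j)))
  ... | no _ = count (λ j → Q? (suc j))

  record Multichain (n : ℕ) : Set (c Level.⊔ ℓ₁ Level.⊔ ℓ₂) where
    field
      x      : Fin (suc n) → Carrier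
      start  : x zero ≈ ⊥
      end    : x (fromℕ n) ≈ ⊤
      mono   : ∀ (i : Fin n) → x (inject₁ i) ≤ x (suc i)

  module _ {n : ℕ} (C : Multichain n) where
    open Multichain C

    -- Block A_i (for i = 1..n, here indexed by i : Fin n, block i+1):
    -- atoms a with a ≤ x_i and a ≰ x_{i-1}.
    InBlock : Fin n → Carrier → Set _
    InBlock i a = IsAtom a × (a ≤ x (suc i)) × ¬ (a ≤ x (inject₁ i))

    inBlock? : ∀ i a → Dec (InBlock i a)
    inBlock? i a = isAtom? a ×-dec (a ≤? x (suc i)) ×-dec ¬? (a ≤? x (inject₁ i))

    N : Fin n → Carrier → ℕ
    N i y = count (λ j → inBlock? i (enum j) ×-dec (enum j ≤? y))

module Submission where

open import Defs
open import Level using (Level)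
open import Data.Nat using (ℕ)
open import Data.Fin using (Fin)
open import Data.Product using (∃; _×_)
open import Relation.Nullary using (¬_)
open import Relation.Binary.PropositionalEquality using (_≡_; _≢_)

open import Data.Nat as ℕ using (zero; suc; _+_; _∸_; z≤n; s≤s)
import Data.Nat.Properties as ℕ
open import Data.Fin as Fin using (toℕ; inject₁; inject; fromℕ<)
open import Data.Fin.Properties
  using (toℕ-injective; toℕ-inject₁; toℕ-inject; toℕ-fromℕ<; all?; ¬∀⟶∃¬-smallest; <-cmp)
open import Data.Product using (_,_; proj₁; proj₂)
open import Data.Empty using (⊥-elim)
open import Function using (_∘_)
open import Relation.Nullary using (Dec; yes; no)
open import Relation.Nullary.Decidable using (_×-dec_)
open import Relation.Binary using (tri<; tri≈; tri>)
open import Relation.Binary.PropositionalEquality using (refl; sym; trans; subst)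

-- Let k be the first block meeting A_x. Cutting x down to y = x ∧ x_k keeps
-- the atoms of A_k ∩ A_x and kills those of every later block (they are not
-- below x_k), while earlier blocks already miss A_x. So y is again a nonzero
-- element with no N_i equal to 1, and y ≤ x; minimality forces y = x, so only
-- block k meets A_x.

inject-fromℕ< : ∀ {n} {k i : Fin n} (i<k : i Fin.< k) → inject {i = k} (fromℕ< i<k) ≡ i
inject-fromℕ< i<k = toℕ-injective (trans (toℕ-inject (fromℕ< i<k)) (toℕ-fromℕ< i<k))

module _ {c ℓ₁ ℓ₂ : Level} (L : FiniteLattice c ℓ₁ ℓ₂) where
  open FiniteLattice L renaming (refl to ≤-refl; trans to ≤-trans)
  open FL L

  count-mono : ∀ {m p q} {Q : Fin m → Set p} {R : Fin m → Set q}
               (Q? : ∀ j → Dec (Q j)) (R? : ∀ j → Dec (R j)) →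
               (∀ j → Q j → R j) → count Q? ℕ.≤ count R?
  count-mono {zero} Q? R? Q⇒R = z≤n
  count-mono {suc m} Q? R? Q⇒R with Q? Fin.zero | R? Fin.zero
  ... | yes _ | yes _ = s≤s (count-mono (Q? ∘ Fin.suc) (R? ∘ Fin.suc) (Q⇒R ∘ Fin.suc))
  ... | no _  | yes _ = ℕ.m≤n⇒m≤1+n (count-mono (Q? ∘ Fin.suc) (R? ∘ Fin.suc) (Q⇒R ∘ Fin.suc))
  ... | no _  | no _  = count-mono (Q? ∘ Fin.suc) (R? ∘ Fin.suc) (Q⇒R ∘ Fin.suc)
  ... | yes q | no ¬r = ⊥-elim (¬r (Q⇒R Fin.zero q))

  count-none : ∀ {m p} {Q : Fin m → Set p} (Q? : ∀ j → Dec (Q j)) → (∀ j → ¬ Q j) → count Q? ≡ 0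
  count-none {zero} Q? ¬Q = refl
  count-none {suc m} Q? ¬Q with Q? Fin.zero
  ... | yes q = ⊥-elim (¬Q Fin.zero q)
  ... | no _  = count-none (Q? ∘ Fin.suc) (¬Q ∘ Fin.suc)

  count-witness : ∀ {m p} {Q : Fin m → Set p} (Q? : ∀ j → Dec (Q j)) → count Q? ≢ 0 → ∃ Q
  count-witness {zero} Q? count≢0 = ⊥-elim (count≢0 refl)
  count-witness {suc m} Q? count≢0 with Q? Fin.zero
  ... | yes q = Fin.zero , q
  ... | no _  = let j , q = count-witness (Q? ∘ Fin.suc) count≢0 in Fin.suc j , q

  trivial-if-length-0 : Multichain 0 → ∀ z → z ≈ ⊥
  trivial-if-length-0 C z = antisym (≤-respʳ-≈ ⊤≈⊥ (maximum z)) (minimum z)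
    where
    ⊤≈⊥ : ⊤ ≈ ⊥
    ⊤≈⊥ = Eq.trans (Eq.sym (Multichain.end C)) (Multichain.start C)

  module _ {n : ℕ} (C : Multichain n) where
    open Multichain C renaming (x to chain)

    chain-mono-+ : ∀ d {a b : Fin (suc n)} → toℕ b ≡ d + toℕ a → chain a ≤ chain b
    chain-mono-+ zero {a} {b} b≡a with toℕ-injective {i = a} {j = b} (sym b≡a)
    ... | refl = ≤-refl
    chain-mono-+ (suc d) {b = Fin.zero} ()
    chain-mono-+ (suc d) {a} {Fin.suc b} b≡d+a =
      ≤-trans (chain-mono-+ d (trans (toℕ-inject₁ b) (ℕ.suc-injective b≡d+a))) (mono b)

    chain-mono : ∀ {a b : Fin (suc n)} → a Fin.≤ b → chain a ≤ chain b
    chain-mono {a} {b} a≤b = chain-mono-+ (toℕ b ∸ toℕ a) (sym (ℕ.m∸n+n≡m a≤b))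

    inBlockBelow? : ∀ i z j → Dec (InBlock C i (enum j) × (enum j ≤ z))
    inBlockBelow? i z j = inBlock? C i (enum j) ×-dec (enum j ≤? z)

    N-mono : ∀ i {y z} → y ≤ z → N C i y ℕ.≤ N C i z
    N-mono i y≤z = count-mono (inBlockBelow? i _) (inBlockBelow? i _)
      λ j (inBlock , j≤y) → inBlock , ≤-trans j≤y y≤z

    N-cong : ∀ i {y z} → y ≈ z → N C i y ≡ N C i z
    N-cong i y≈z = ℕ.≤-antisym (N-mono i (reflexive y≈z)) (N-mono i (reflexive (Eq.sym y≈z)))

    N-∧-block-top : ∀ i z → N C i (z ∧ chain (Fin.suc i)) ≡ N C i z
    N-∧-block-top i z = ℕ.≤-antisym (N-mono i (x∧y≤x _ _))
      (count-mono (inBlockBelow? i z) (inBlockBelow? i _)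
        λ j (inBlock , j≤z) → inBlock , ∧-greatest j≤z (proj₁ (proj₂ inBlock)))

    N≡0-above : ∀ {k i} → k Fin.< i → ∀ {z} → z ≤ chain (Fin.suc k) → N C i z ≡ 0
    N≡0-above {k} {i} k<i z≤top = count-none (inBlockBelow? i _) λ j ((_ , _ , j≰prev) , j≤z) →
      j≰prev (≤-trans (≤-trans j≤z z≤top) (chain-mono (subst (ℕ._≤_ _) (sym (toℕ-inject₁ i)) k<i)))

    N≢0⇒≉⊥ : ∀ i {z} → N C i z ≢ 0 → ¬ z ≈ ⊥
    N≢0⇒≉⊥ i {z} N≢0 z≈⊥ with count-witness (inBlockBelow? i z) N≢0
    ... | j , ((⊥<j , _) , _) , j≤z = proj₂ ⊥<j (antisym (minimum _) (≤-respʳ-≈ z≈⊥ j≤z))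

    NoSingletonBlock : Carrier → Set
    NoSingletonBlock z = ∀ i → N C i z ≢ 1

    module _ {x : Carrier} {k : Fin n} (N[k]≢0 : N C k x ≢ 0)
             (N≡0-before : ∀ i → i Fin.< k → N C i x ≡ 0) where

      cut : Carrier
      cut = x ∧ chain (Fin.suc k)

      cut≉⊥ : ¬ cut ≈ ⊥
      cut≉⊥ = N≢0⇒≉⊥ k (N[k]≢0 ∘ trans (sym (N-∧-block-top k x)))

      cut-noSingletonBlock : NoSingletonBlock x → NoSingletonBlock cut
      cut-noSingletonBlock N≢1 i with <-cmp i k
      ... | tri< i<k _ _ = ℕ.0≢1+n ∘ trans (sym (ℕ.n≤0⇒n≡0 N[i]≤0))
        where
        N[i]≤0 : N C i cut ℕ.≤ 0
        N[i]≤0 = subst (ℕ._≤_ _) (N≡0-before i i<k) (N-mono i (x∧y≤x _ _))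
      ... | tri≈ _ refl _ = N≢1 k ∘ trans (sym (N-∧-block-top k x))
      ... | tri> _ _ k<i = ℕ.0≢1+n ∘ trans (sym (N≡0-above k<i (x∧y≤y _ _)))

      minimal⇒only-block : NoSingletonBlock x →
        (∀ y → ¬ y ≈ ⊥ → NoSingletonBlock y → y ≤ x → y ≈ x) →
        ∀ i → i ≢ k → N C i x ≡ 0
      minimal⇒only-block N≢1 minimal i i≢k with <-cmp i k
      ... | tri< i<k _ _ = N≡0-before i i<k
      ... | tri≈ _ i≡k _ = ⊥-elim (i≢k i≡k)
      ... | tri> _ _ k<i = trans (N-cong i (Eq.sym cut≈x)) (N≡0-above k<i (x∧y≤y _ _))
        where
        cut≈x : cut ≈ x
        cut≈x = minimal cut cut≉⊥ (cut-noSingletonBlock N≢1) (x∧y≤x _ _)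

lemma5p2 : ∀ {c ℓ₁ ℓ₂ : Level} (L : FiniteLattice c ℓ₁ ℓ₂) (n : ℕ) (C : FL.Multichain L n) (x : FiniteLattice.Carrier L) →
    ¬ (FiniteLattice._≈_ L x (FiniteLattice.⊥ L)) →
    (∀ i → FL.N L C i x ≢ 1) →
    (∀ y → ¬ (FiniteLattice._≈_ L y (FiniteLattice.⊥ L)) → (∀ i → FL.N L C i y ≢ 1) → FiniteLattice._≤_ L y x → FiniteLattice._≈_ L y x) →
    ∃ λ (j : Fin n) → ∀ i → i ≢ j → FL.N L C i x ≡ 0
lemma5p2 L n C x x≉⊥ N≢1 minimal with all? (λ i → FL.N L C i x ℕ.≟ 0)
lemma5p2 L (suc n) C x x≉⊥ N≢1 minimal | yes allZero = Fin.zero , λ i _ → allZero i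
lemma5p2 L zero    C x x≉⊥ N≢1 minimal | yes _ = ⊥-elim (x≉⊥ (trivial-if-length-0 L C x))
lemma5p2 L n C x x≉⊥ N≢1 minimal | no ¬allZero
  with ¬∀⟶∃¬-smallest n _ (λ i → FL.N L C i x ℕ.≟ 0) ¬allZero
... | k , N[k]≢0 , zeroBefore = k , minimal⇒only-block L C N[k]≢0 N≡0-before N≢1 minimal
  where
  N≡0-before : ∀ i → i Fin.< k → FL.N L C i x ≡ 0
  N≡0-before i i<k = subst (λ i → FL.N L C i x ≡ 0) (inject-fromℕ< i<k) (zeroBefore (fromℕ< i<k))
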